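{- Let $W$ be a valid move sequence, $\tau_0\in\{\pm1\}^{V(W)}$, and let $H$ be its auxiliary multigraph. Let $V_1,V_2\subseteq V(W)$ be disjoint and let $E''$ be a set of edges of $H$, each having one endpoint in $V_1$ and the other in $V_2$ and each corresponding to a 2-move of $W$ of the same sign. Let $D$ be the set of nodes of $V_1$ that are incident to (at least two) parallel edges of $E''$. Then $\mathrm{rank}_{\mathrm{cycles}}(W)\ge|D|/2$.
   Context: $V_n=[n]$, $K_n=(V_n,E_n)$ complete graph. A move sequence is $W=(W_1,\dots,W_L)$ with each $W_i\subseteq V_n$ of size 1 or 2; $V(W)$ is the set of nodes occurring in $W$, $E(W)$ the edges of $K_n$ with both endpoints in $V(W)$. $W$ is valid if for all $i<j\le L$ some node $w\notin W_i$ belongs to an odd number of $W_i,\dots,W_j$. For $\tau_0\in\{\pm1\}^{V(W)}$, $\tau_i$ is obtained from $\tau_{i-1}$ by flipping the nodes of $W_i$; a 2-move $W_i=\{u,v\}$ is of the same sign if $\tau_i(u)=\tau_i(v)$. The auxiliary multigraph $H$ on $V(W)$ has one edge $\{u,v\}$ for each 2-move $W_i=\{u,v\}$ (parallel edges allowed; edges correspond to moves). $\mathrm{imprv}_{\tau_0,W}(i)\in\{0,\pm1\}^{E(W)}$: if $W_i=\{u\}$, its entry at $\{u,w\}$ is $\tau_{i-1}(u)\tau_{i-1}(w)$, other entries 0; if $W_i=\{u,v\}$, its entry at $\{u,w\}$ ($w\notin\{u,v\}$) is $\tau_{i-1}(u)\tau_{i-1}(w)$, at $\{v,w\}$ ($w\notin\{u,v\}$)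 is $\tau_{i-1}(v)\tau_{i-1}(w)$, others 0. A cycle is a tuple $(c_1,\dots,c_t)$, $t\ge2$, of distinct indices with $W_{c_j}=\{u_j,u_{j+1}\}$ ($j<t$), $W_{c_t}=\{u_t,u_1\}$; it is dependent if some $b\in\{\pm1\}^t$ satisfies $b_j\tau_{c_j}(u_{j+1})+b_{j+1}\tau_{c_{j+1}}(u_{j+1})=0$ ($j\in[t-1]$) and $b_t\tau_{c_t}(u_1)+b_1\tau_{c_1}(u_1)=0$; with the unique such $b$ having $b_1=1$, its vector is $\sum_j b_j\mathrm{imprv}_{\tau_0,W}(c_j)$. $\mathrm{rank}_{\mathrm{cycles}}(W)$ is the rank of the set of vectors of all dependent cycles of $W$ (it does not depend on $\tau_0$). -}

module Defs where

open import Data.Bool using (Bool; true; false; if_then_else_; _∨_; _xor_)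
open import Data.Nat as ℕ using (ℕ; zero; suc; _∸_; _≤_)
open import Data.Nat.DivMod using (_mod_)
open import Data.Fin as Fin using (Fin; toℕ)
open import Data.Fin.Subset using (Subset; _∈_; _∉_; ∣_∣)
open import Data.Sign as Sign using (Sign)
open import Data.Integer as ℤ using (ℤ; _◃_)
open import Data.Rational as ℚ using (ℚ; 0ℚ)
open import Data.List as List using (List; []; _∷_; length; lookup; take; drop; foldl; foldr; map; allFin)
open import Data.List.Relation.Unary.Any using (Any)
open import Data.Empty using (⊥)
open import Data.Unit using (⊤)
open import Data.Sum using (_⊎_)
open import Data.Product using (Σ; ∃; ∃-syntax; _×_; _,_)
open import Relation.Nullary using (¬_; ⌊_⌋)
open import Relation.Binary.PropositionalEquality using (_≡_; _≢_)
open import Function using (Injective)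

data Move (n : ℕ) : Set where
  one : Fin n → Move n
  two : (u v : Fin n) → u ≢ v → Move n

isIn : ∀ {n} → Fin n → Move n → Bool
isIn w (one u)     = ⌊ w Fin.≟ u ⌋
isIn w (two u v _) = ⌊ w Fin.≟ u ⌋ ∨ ⌊ w Fin.≟ v ⌋

IsTwoMove : ∀ {n} → Move n → Set
IsTwoMove (one _)     = ⊥
IsTwoMove (two _ _ _) = ⊤

SameSet : ∀ {n} → Move n → Move n → Set
SameSet m m′ = ∀ w → isIn w m ≡ isIn w m′

MoveSeq : ℕ → Set
MoveSeq n = List (Move n)

-- positions (0-based) of a move sequence; position p is the move W_{p+1}
Pos : ∀ {n} → MoveSeq n → Set
Pos W = Fin (length W)

move : ∀ {n} (W : MoveSeq n) → Pos W → Move n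
move W p = lookup W p

occ : ∀ {n} → Fin n → List (Move n) → ℕ
occ w []       = 0
occ w (m ∷ ms) = (if isIn w m then 1 else 0) ℕ.+ occ w ms

segment : ∀ {n} (W : MoveSeq n) → Pos W → Pos W → List (Move n)
segment W i j = take (suc (toℕ j) ∸ toℕ i) (drop (toℕ i) W)

Valid : ∀ {n} → MoveSeq n → Set
Valid {n} W = ∀ (i j : Pos W) → toℕ i ℕ.< toℕ j →
  ∃[ w ] (isIn w (move W i) ≡ false × occ w (segment W i j) ℕ.% 2 ≡ 1)

InV : ∀ {n} → MoveSeq n → Fin n → Set
InV W w = Any (λ m → isIn w m ≡ true) W

-- Signs / configurations.  τ₀ is given on all of V_n; only its values on
-- V(W) matter.

Config : ℕ → Set
Config n = Fin n → Sign

applyMove : ∀ {n} → Config n → Move n → Config n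
applyMove τ m w = if isIn w m then Sign.opposite (τ w) else τ w

tau : ∀ {n} → Config n → MoveSeq n → ℕ → Config n
tau τ₀ W k = foldl applyMove τ₀ (take k W)

-- τ_{p+1} for a 0-based position p (configuration right after move W_{p+1})
tauAfter : ∀ {n} → Config n → (W : MoveSeq n) → Pos W → Config n
tauAfter τ₀ W p = tau τ₀ W (suc (toℕ p))

-- τ_p for a 0-based position p (configuration right before move W_{p+1})
tauBefore : ∀ {n} → Config n → (W : MoveSeq n) → Pos W → Config n
tauBefore τ₀ W p = tau τ₀ W (toℕ p)

signℤ : Sign → ℤ
signℤ s = s ◃ 1

-- Vectors indexed by edges: the entry at edge {a,b} is v a b (only
-- pairs a < b with a, b ∈ V(W) are coordinates of ℤ^{E(W)}).

EdgeVec : ℕ → Set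
EdgeVec n = Fin n → Fin n → ℤ

imprv : ∀ {n} → Config n → (W : MoveSeq n) → Pos W → EdgeVec n
imprv τ₀ W p a b =
  if isIn a (move W p) xor isIn b (move W p)
  then signℤ (τ a Sign.* τ b) else ℤ.0ℤ
  where τ = tauBefore τ₀ W p

sumℤ : List ℤ → ℤ
sumℤ = foldr ℤ._+_ ℤ.0ℤ

sumℚ : List ℚ → ℚ
sumℚ = foldr ℚ._+_ 0ℚ

next : ∀ {s} → Fin (suc s) → Fin (suc s)
next {s} j = suc (toℕ j) mod suc s

-- Cycles: (c_1,…,c_t), t ≥ 2 (here t = suc s, s ≥ 1), distinct positions,
-- with W_{c_j} = {u_j, u_{j+1}} (indices cyclic).

record Cycle {n} (W : MoveSeq n) : Set where
  field
    s      : ℕ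
    t≥2    : 1 ≤ s
    c      : Fin (suc s) → Pos W
    c-inj  : Injective _≡_ _≡_ c
    u      : Fin (suc s) → Fin n
    two-mv : ∀ j → IsTwoMove (move W (c j))
    edge   : ∀ j w → isIn w (move W (c j)) ≡ (⌊ w Fin.≟ u j ⌋ ∨ ⌊ w Fin.≟ u (next j) ⌋)

DepCycleVec : ∀ {n} → Config n → (W : MoveSeq n) → EdgeVec n → Set
DepCycleVec {n} τ₀ W x = Σ (Cycle W) λ C → let open Cycle C in
  Σ (Fin (suc s) → Sign) λ b →
    b Fin.zero ≡ Sign.+
  × (∀ j → signℤ (b j Sign.* tauAfter τ₀ W (c j) (u (next j)))
            ℤ.+ signℤ (b (next j) Sign.* tauAfter τ₀ W (c (next j)) (u (next j)))
           ≡ ℤ.0ℤ)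
  × (∀ a a′ → x a a′ ≡ sumℤ (map (λ j → signℤ (b j) ℤ.* imprv τ₀ W (c j) a a′) (allFin (suc s))))

toℚ : ℤ → ℚ
toℚ z = z ℚ./ 1

LinIndep : ∀ {n} (W : MoveSeq n) {r : ℕ} → (Fin r → EdgeVec n) → Set
LinIndep {n} W {r} vs = ∀ (λs : Fin r → ℚ) →
  (∀ a b → a Fin.< b → InV W a → InV W b →
     sumℚ (map (λ i → λs i ℚ.* toℚ (vs i a b)) (allFin r)) ≡ 0ℚ) →
  ∀ i → λs i ≡ 0ℚ

RankCyclesAtLeast : ∀ {n} → Config n → MoveSeq n → ℕ → Set
RankCyclesAtLeast τ₀ W r =
  Σ (Fin r → EdgeVec _) λ vs → (∀ i → DepCycleVec τ₀ W (vs i)) × LinIndep W vs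

CrossSameSign : ∀ {n} → Config n → (W : MoveSeq n) → Subset n → Subset n → Pos W → Set
CrossSameSign τ₀ W V₁ V₂ p =
  ∃[ u ] ∃[ v ] Σ (u ≢ v) λ u≢v →
    move W p ≡ two u v u≢v
  × ((u ∈ V₁ × v ∈ V₂) ⊎ (v ∈ V₁ × u ∈ V₂))
  × tauAfter τ₀ W p u ≡ tauAfter τ₀ W p v

InD : ∀ {n} (W : MoveSeq n) → Subset (length W) → Subset n → Fin n → Set
InD W E″ V₁ x = x ∈ V₁ ×
  ∃[ p ] ∃[ q ] (p ≢ q × p ∈ E″ × q ∈ E″
                 × isIn x (move W p) ≡ true × SameSet (move W p) (move W q))

module Submission where

open import Defs
open import Data.Nat using (ℕ; _≤_; _*_)
open import Data.Fin.Subset using (Subset; _∈_; _∉_; ∣_∣)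
open import Data.List using (length)
open import Data.Product using (Σ; ∃; ∃-syntax; _×_)
open import Function.Bundles using (_⇔_)

open import Data.Bool as Bool using (true; false; if_then_else_; _∨_)
open import Data.Bool.Properties using (∨-comm; ∨-zeroʳ)
open import Data.Empty using (⊥-elim)
open import Data.Fin as Fin using (Fin; toℕ)
import Data.Fin.Properties as Fin
open import Data.Fin.Subset using (_─_; _-_; _⊆_; ⁅_⁆; Nonempty; inside; outside)
open import Data.Fin.Subset.Properties
  using (_∈?_; x∈⁅x⁆; p─⊥≡p; p─q⊆p; p⊆q⇒∣p∣≤∣q∣; x∈p⇒∣p-x∣<∣p∣; nonempty?; Empty-unique; ∣⊥∣≡0)
open import Data.Integer as ℤ using (ℤ; 0ℤ)
import Data.Integer.Properties as ℤ
open import Data.List using (List; []; _∷_; _++_; take; drop; foldl; map; allFin; lookup)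
import Data.List.Properties as List
open import Data.List.Membership.Propositional.Properties using (∈-lookup)
open import Data.List.Relation.Binary.Sublist.Propositional using (⊆-trans)
open import Data.List.Relation.Binary.Sublist.Propositional.Properties using (Any-resp-⊆; take-⊆; drop-⊆)
open import Data.List.Relation.Unary.All as All using (All; []; _∷_)
open import Data.List.Relation.Unary.Any using (Any; here; there)
open import Data.Nat as ℕ using (zero; suc; _+_; _∸_; _<_; z≤n; s≤s)
import Data.Nat.Properties as ℕ
open import Data.Nat.DivMod using (_%_; _/_; m≡m%n+[m/n]*n; m%n<n)
open import Data.Product using (_,_; proj₁; proj₂)
open import Data.Rational as ℚ using (ℚ; 0ℚ; 1ℚ)
import Data.Rational.Properties as ℚ
open import Data.Sign as Sign using (Sign)
import Data.Sign.Properties as Sign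
open import Data.Sum using (_⊎_; inj₁; inj₂)
open import Data.Unit using (⊤; tt)
open import Data.Vec using (_∷_; here; there)
open import Data.Vec.Properties.WithK using ([]=-irrelevant)
open import Function using (_∘_; id)
open import Function.Bundles using (Equivalence)
open import Relation.Binary.Definitions using (Tri; tri<; tri≈; tri>)
open import Relation.Binary.PropositionalEquality
open import Relation.Nullary using (¬_; Dec; ⌊_⌋; yes; no)
open import Relation.Nullary.Decidable using (isYes≗does; dec-true; dec-false; _×-dec_; ¬?; map′)
open import Relation.Unary using (Decidable)

-- For x ∈ D take two parallel edges W_p = W_q = {x, y} of E″ (p < q, y ∈ V₂).
-- As both moves are of the same sign, (p, q) is a dependent 2-cycle. Its
-- vector vanishes off the edges {a, w} with a ∈ {x, y}, w ∉ {x, y}, and there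
-- it is ±2 exactly when w is flipped an odd number of times by W_p … W_q;
-- validity provides such a w for the pair (p, q). A greedy elimination then
-- picks, inside the remaining set R ⊆ D, a vector with an entry {x, w} on
-- which every other vector of R vanishes, except possibly that of w, and
-- removes x and w. The chosen vectors form a triangular, hence independent,
-- family, and each of them uses up at most two elements of D.

flips : ℕ → Sign → Sign
flips zero    s = s
flips (suc k) s = Sign.opposite (flips k s)

flips-+ : ∀ j k s → flips (j + k) s ≡ flips j (flips k s)
flips-+ zero    k s = refl
flips-+ (suc j) k s = cong Sign.opposite (flips-+ j k s)

flips-even : ∀ k s → flips (k * 2) s ≡ s
flips-even zero    s = refl
flips-even (suc k) s = trans (Sign.opposite-involutive _) (flips-even k s)

flips-%2 : ∀ k s → flips k s ≡ flips (k % 2) s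
flips-%2 k s = begin
  flips k s                            ≡⟨ cong (λ m → flips m s) (m≡m%n+[m/n]*n k 2) ⟩
  flips (k % 2 + k / 2 * 2) s          ≡⟨ flips-+ (k % 2) _ s ⟩
  flips (k % 2) (flips (k / 2 * 2) s)  ≡⟨ cong (flips (k % 2)) (flips-even (k / 2) s) ⟩
  flips (k % 2) s                      ∎
  where open ≡-Reasoning

m%2≡0⊎m%2≡1 : ∀ m → m % 2 ≡ 0 ⊎ m % 2 ≡ 1
m%2≡0⊎m%2≡1 m with m % 2 | m%n<n m 2
... | 0           | _               = inj₁ refl
... | 1           | _               = inj₂ refl
... | suc (suc _) | s≤s (s≤s ())

module _ {n : ℕ} where

  count : Fin n → Move n → ℕ
  count w m = if isIn w m then 1 else 0

  applyMove-∈ : ∀ (τ : Config n) m w → isIn w m ≡ true → applyMove τ m w ≡ Sign.opposite (τ w)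
  applyMove-∈ τ m w w∈m rewrite w∈m = refl

  applyMove-∉ : ∀ (τ : Config n) m w → isIn w m ≡ false → applyMove τ m w ≡ τ w
  applyMove-∉ τ m w w∉m rewrite w∉m = refl

  applyMove-flips : ∀ (τ : Config n) m w → applyMove τ m w ≡ flips (count w m) (τ w)
  applyMove-flips τ m w with isIn w m
  ... | true  = refl
  ... | false = refl

  foldl-applyMove : ∀ (τ : Config n) L w → foldl applyMove τ L w ≡ flips (occ w L) (τ w)
  foldl-applyMove τ []      w = refl
  foldl-applyMove τ (m ∷ L) w = begin
    foldl applyMove (applyMove τ m) L w         ≡⟨ foldl-applyMove (applyMove τ m) L w ⟩
    flips (occ w L) (applyMove τ m w)           ≡⟨ cong (flips (occ w L)) (applyMove-flips τ m w) ⟩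
    flips (occ w L) (flips (count w m) (τ w))   ≡⟨ flips-+ (occ w L) (count w m) (τ w) ⟨
    flips (occ w L + count w m) (τ w)           ≡⟨ cong (λ k → flips k (τ w)) (ℕ.+-comm (occ w L) _) ⟩
    flips (occ w (m ∷ L)) (τ w)                 ∎
    where open ≡-Reasoning

  occ-odd⇒Any : ∀ w (L : List (Move n)) → occ w L % 2 ≡ 1 → Any (λ m → isIn w m ≡ true) L
  occ-odd⇒Any w []      ()
  occ-odd⇒Any w (m ∷ L) odd with isIn w m in w∈m
  ... | true  = here w∈m
  ... | false = there (occ-odd⇒Any w L odd)

take-+ : ∀ {A : Set} j k (xs : List A) → take (j + k) xs ≡ take j xs ++ take k (drop j xs)
take-+ zero    k xs       = refl
take-+ (suc j) k []       = sym (List.take-[] k)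
take-+ (suc j) k (x ∷ xs) = cong (x ∷_) (take-+ j k xs)

⌊⌋-true : ∀ {A : Set} (a? : Dec A) → A → ⌊ a? ⌋ ≡ true
⌊⌋-true a? a = trans (isYes≗does a?) (dec-true a? a)

⌊⌋-false : ∀ {A : Set} (a? : Dec A) → ¬ A → ⌊ a? ⌋ ≡ false
⌊⌋-false a? ¬a = trans (isYes≗does a?) (dec-false a? ¬a)

record Joins {n} (m : Move n) (x y : Fin n) : Set where
  constructor joining
  field isIn-joins : ∀ w → isIn w m ≡ (⌊ w Fin.≟ x ⌋ ∨ ⌊ w Fin.≟ y ⌋)

module _ {n : ℕ} {m : Move n} {x y : Fin n} (joins : Joins m x y) where
  open Joins joins

  joins-sym : Joins m y x
  joins-sym = joining λ w → trans (isIn-joins w) (∨-comm ⌊ w Fin.≟ x ⌋ _)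

  joins-left : isIn x m ≡ true
  joins-left = trans (isIn-joins x) (cong (_∨ ⌊ x Fin.≟ y ⌋) (⌊⌋-true (x Fin.≟ x) refl))

  joins-right : isIn y m ≡ true
  joins-right = trans (isIn-joins y) (trans (cong (⌊ y Fin.≟ x ⌋ ∨_) (⌊⌋-true (y Fin.≟ y) refl)) (∨-zeroʳ ⌊ y Fin.≟ x ⌋))

  joins-∉ : ∀ {a} → a ≢ x → a ≢ y → isIn a m ≡ false
  joins-∉ {a} a≢x a≢y = trans (isIn-joins a) (cong₂ _∨_ (⌊⌋-false (a Fin.≟ x) a≢x) (⌊⌋-false (a Fin.≟ y) a≢y))

  joins-∈ : ∀ {a} → isIn a m ≡ true → a ≡ x ⊎ a ≡ y
  joins-∈ {a} a∈ with a Fin.≟ x | a Fin.≟ y | trans (sym (isIn-joins a)) a∈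
  ... | yes a≡x | _       | _ = inj₁ a≡x
  ... | no _    | yes a≡y | _ = inj₂ a≡y
  ... | no _    | no _    | ()

-- The entry of a 2-cycle vector at {a, a′}, a ∈ W_p = W_q ∌ a′, in terms of
-- s = σ(a) = σ(y), r = ρ(y), t = σ(a′), t′ = ρ(a′), where σ and ρ are the
-- configurations just before W_p and W_q.
crossEntry : Sign → Sign → Sign → Sign → ℤ
crossEntry s r t t′ =
  signℤ Sign.+ ℤ.* signℤ (s Sign.* t)
    ℤ.+ (signℤ (Sign.opposite (Sign.opposite s Sign.* Sign.opposite r)) ℤ.* signℤ (r Sign.* t′) ℤ.+ 0ℤ)

crossEntry-≡ : ∀ s r t → crossEntry s r t t ≡ 0ℤ
crossEntry-≡ Sign.+ Sign.+ Sign.+ = refl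
crossEntry-≡ Sign.+ Sign.+ Sign.- = refl
crossEntry-≡ Sign.+ Sign.- Sign.+ = refl
crossEntry-≡ Sign.+ Sign.- Sign.- = refl
crossEntry-≡ Sign.- Sign.+ Sign.+ = refl
crossEntry-≡ Sign.- Sign.+ Sign.- = refl
crossEntry-≡ Sign.- Sign.- Sign.+ = refl
crossEntry-≡ Sign.- Sign.- Sign.- = refl

crossEntry-opposite : ∀ s r t → toℚ (crossEntry s r t (Sign.opposite t)) ≢ 0ℚ
crossEntry-opposite Sign.+ Sign.+ Sign.+ ()
crossEntry-opposite Sign.+ Sign.+ Sign.- ()
crossEntry-opposite Sign.+ Sign.- Sign.+ ()
crossEntry-opposite Sign.+ Sign.- Sign.- ()
crossEntry-opposite Sign.- Sign.+ Sign.+ ()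
crossEntry-opposite Sign.- Sign.+ Sign.- ()
crossEntry-opposite Sign.- Sign.- Sign.+ ()
crossEntry-opposite Sign.- Sign.- Sign.- ()

module MoveSequence {n : ℕ} (W : MoveSeq n) (τ₀ : Config n) where

  tauAfter-applyMove : ∀ p w → tauAfter τ₀ W p w ≡ applyMove (tauBefore τ₀ W p) (move W p) w
  tauAfter-applyMove p w =
    trans (cong (λ L → foldl applyMove τ₀ L w) (List.take-suc W p))
          (cong (λ τ → τ w) (List.foldl-∷ʳ applyMove τ₀ (move W p) (take (toℕ p) W)))

  tauAfter-∈ : ∀ p w → isIn w (move W p) ≡ true → tauAfter τ₀ W p w ≡ Sign.opposite (tauBefore τ₀ W p w)
  tauAfter-∈ p w w∈ = trans (tauAfter-applyMove p w) (applyMove-∈ (tauBefore τ₀ W p) (move W p) w w∈)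

  take-segment : ∀ (p q : Pos W) → toℕ p < toℕ q → take (suc (toℕ q)) W ≡ take (toℕ p) W ++ segment W p q
  take-segment p q p<q =
    trans (cong (λ k → take k W) (sym (ℕ.m+[n∸m]≡n (ℕ.m≤n⇒m≤1+n (ℕ.<⇒≤ p<q)))))
          (take-+ (toℕ p) (suc (toℕ q) ∸ toℕ p) W)

  -- The segment W_p … W_q ends with W_q, hence the hypothesis w ∉ W_q.
  tauBefore-segment : ∀ (p q : Pos W) → toℕ p < toℕ q → ∀ w → isIn w (move W q) ≡ false →
                      tauBefore τ₀ W q w ≡ flips (occ w (segment W p q)) (tauBefore τ₀ W p w)
  tauBefore-segment p q p<q w w∉ = begin
    tauBefore τ₀ W q w                                     ≡⟨ applyMove-∉ (tauBefore τ₀ W q) (move W q) w w∉ ⟨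
    applyMove (tauBefore τ₀ W q) (move W q) w              ≡⟨ tauAfter-applyMove q w ⟨
    foldl applyMove τ₀ (take (suc (toℕ q)) W) w            ≡⟨ cong (λ L → foldl applyMove τ₀ L w) (take-segment p q p<q) ⟩
    foldl applyMove τ₀ (take (toℕ p) W ++ segment W p q) w ≡⟨ cong (λ τ → τ w) (List.foldl-++ applyMove τ₀ (take (toℕ p) W) _) ⟩
    foldl applyMove (tauBefore τ₀ W p) (segment W p q) w   ≡⟨ foldl-applyMove (tauBefore τ₀ W p) (segment W p q) w ⟩
    flips (occ w (segment W p q)) (tauBefore τ₀ W p w)     ∎
    where open ≡-Reasoning

  segment-odd⇒InV : ∀ (p q : Pos W) w → occ w (segment W p q) % 2 ≡ 1 → InV W w
  segment-odd⇒InV p q w odd =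
    Any-resp-⊆ (⊆-trans (take-⊆ (suc (toℕ q) ∸ toℕ p) (drop (toℕ p) W)) (drop-⊆ (toℕ p) W)) (occ-odd⇒Any w _ odd)

  imprv-sym : ∀ p a a′ → imprv τ₀ W p a a′ ≡ imprv τ₀ W p a′ a
  imprv-sym p a a′ with isIn a (move W p) | isIn a′ (move W p)
  ... | true  | true  = refl
  ... | true  | false = cong signℤ (Sign.*-comm (tauBefore τ₀ W p a) _)
  ... | false | true  = cong signℤ (Sign.*-comm (tauBefore τ₀ W p a) _)
  ... | false | false = refl

  imprv-∉∉ : ∀ p a a′ → isIn a (move W p) ≡ false → isIn a′ (move W p) ≡ false → imprv τ₀ W p a a′ ≡ 0ℤ
  imprv-∉∉ p a a′ a∉ a′∉ rewrite a∉ | a′∉ = refl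

  imprv-∈∉ : ∀ p a a′ → isIn a (move W p) ≡ true → isIn a′ (move W p) ≡ false →
             imprv τ₀ W p a a′ ≡ signℤ (tauBefore τ₀ W p a Sign.* tauBefore τ₀ W p a′)
  imprv-∈∉ p a a′ a∈ a′∉ rewrite a∈ | a′∉ = refl

  record SameSignEdge (p : Pos W) (x y : Fin n) : Set where
    field
      joins     : Joins (move W p) x y
      two-move  : IsTwoMove (move W p)
      same-sign : tauAfter τ₀ W p x ≡ tauAfter τ₀ W p y

  record ParallelPair (x : Fin n) : Set where
    field
      y      : Fin n
      p q    : Pos W
      p<q    : toℕ p < toℕ q
      p-edge : SameSignEdge p x y
      q-edge : SameSignEdge q x y

  sameSignEdge : ∀ {p u v} (u≢v : u ≢ v) → move W p ≡ two u v u≢v → tauAfter τ₀ W p u ≡ tauAfter τ₀ W p v →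
                 SameSignEdge p u v
  sameSignEdge {p} u≢v p≡uv same = record
    { joins     = joining λ w → cong (isIn w) p≡uv
    ; two-move  = subst IsTwoMove (sym p≡uv) tt
    ; same-sign = same
    }

  sameSignEdge-sym : ∀ {p x y} → SameSignEdge p x y → SameSignEdge p y x
  sameSignEdge-sym e = record { joins = joins-sym joins ; two-move = two-move ; same-sign = sym same-sign }
    where open SameSignEdge e

  sameSign-before : ∀ {r x y} → SameSignEdge r x y → tauBefore τ₀ W r x ≡ tauBefore τ₀ W r y
  sameSign-before {r} {x} {y} e = Sign.opposite-injective (begin
    Sign.opposite (tauBefore τ₀ W r x)  ≡⟨ tauAfter-∈ r x (joins-left joins) ⟨
    tauAfter τ₀ W r x                   ≡⟨ same-sign ⟩
    tauAfter τ₀ W r y                   ≡⟨ tauAfter-∈ r y (joins-right joins) ⟩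
    Sign.opposite (tauBefore τ₀ W r y)  ∎)
    where
    open SameSignEdge e
    open ≡-Reasoning

  Flipped : ∀ {x} → ParallelPair x → Fin n → Set
  Flipped P w = isIn w (move W p) ≡ false × occ w (segment W p q) % 2 ≡ 1
    where open ParallelPair P

  flipped⇒InV : ∀ {x} (P : ParallelPair x) {w} → Flipped P w → InV W w
  flipped⇒InV P {w} (_ , odd) = segment-odd⇒InV (ParallelPair.p P) (ParallelPair.q P) w odd

  flipped? : ∀ {x} (P : ParallelPair x) → Decidable (Flipped P)
  flipped? P w = (isIn w (move W p) Bool.≟ false) ×-dec (occ w (segment W p q) % 2 ℕ.≟ 1)
    where open ParallelPair P

  module PairCycle {x : Fin n} (P : ParallelPair x) where
    open ParallelPair P
    open SameSignEdge p-edge renaming (joins to p-joins; two-move to p-two; same-sign to p-same)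
    open SameSignEdge q-edge renaming (joins to q-joins; two-move to q-two; same-sign to q-same)

    σ ρ : Config n
    σ = tauBefore τ₀ W p
    ρ = tauBefore τ₀ W q

    -- The second sign is forced by the dependency equation at y; the one at x
    -- then holds because both moves are of the same sign.
    signs : Fin 2 → Sign
    signs Fin.zero           = Sign.+
    signs (Fin.suc Fin.zero) = Sign.opposite (tauAfter τ₀ W p y Sign.* tauAfter τ₀ W q y)

    positions : Fin 2 → Pos W
    positions Fin.zero           = p
    positions (Fin.suc Fin.zero) = q

    nodes : Fin 2 → Fin n
    nodes Fin.zero           = x
    nodes (Fin.suc Fin.zero) = y

    positions-injective : ∀ {i j} → positions i ≡ positions j → i ≡ j
    positions-injective {Fin.zero}           {Fin.zero}           _   = refl
    positions-injective {Fin.zero}           {Fin.suc Fin.zero}   p≡q = ⊥-elim (ℕ.<-irrefl (cong toℕ p≡q) p<q)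
    positions-injective {Fin.suc Fin.zero}   {Fin.zero}           q≡p = ⊥-elim (ℕ.<-irrefl (cong toℕ (sym q≡p)) p<q)
    positions-injective {Fin.suc Fin.zero}   {Fin.suc Fin.zero}   _   = refl

    cycle : Cycle W
    cycle = record
      { s      = 1
      ; t≥2    = s≤s z≤n
      ; c      = positions
      ; c-inj  = positions-injective
      ; u      = nodes
      ; two-mv = λ { Fin.zero → p-two ; (Fin.suc Fin.zero) → q-two }
      ; edge   = λ { Fin.zero → Joins.isIn-joins p-joins ; (Fin.suc Fin.zero) → Joins.isIn-joins (joins-sym q-joins) }
      }

    cycleVec : EdgeVec n
    cycleVec a a′ = sumℤ (map (λ j → signℤ (signs j) ℤ.* imprv τ₀ W (positions j) a a′) (allFin 2))

    cycleVec-dependent : DepCycleVec τ₀ W cycleVec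
    cycleVec-dependent = cycle , signs , refl , balanced , λ _ _ → refl
      where
      balanced-y : ∀ s t → signℤ (Sign.+ Sign.* s) ℤ.+ signℤ (Sign.opposite (s Sign.* t) Sign.* t) ≡ 0ℤ
      balanced-y Sign.+ Sign.+ = refl
      balanced-y Sign.+ Sign.- = refl
      balanced-y Sign.- Sign.+ = refl
      balanced-y Sign.- Sign.- = refl

      balanced : ∀ j → signℤ (signs j Sign.* tauAfter τ₀ W (positions j) (nodes (next j)))
                       ℤ.+ signℤ (signs (next j) Sign.* tauAfter τ₀ W (positions (next j)) (nodes (next j))) ≡ 0ℤ
      balanced Fin.zero           = balanced-y (tauAfter τ₀ W p y) (tauAfter τ₀ W q y)
      balanced (Fin.suc Fin.zero) rewrite q-same | p-same =
        trans (ℤ.+-comm (signℤ (signs (Fin.suc Fin.zero) Sign.* tauAfter τ₀ W q y)) (signℤ (Sign.+ Sign.* tauAfter τ₀ W p y)))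
              (balanced-y (tauAfter τ₀ W p y) (tauAfter τ₀ W q y))

    same-move : ∀ a → isIn a (move W q) ≡ isIn a (move W p)
    same-move a = trans (Joins.isIn-joins q-joins a) (sym (Joins.isIn-joins p-joins a))

    endpoint-sign : ∀ {r} → SameSignEdge r x y → ∀ a → isIn a (move W p) ≡ true → tauBefore τ₀ W r a ≡ tauBefore τ₀ W r y
    endpoint-sign e a a∈ with joins-∈ p-joins {a} a∈
    ... | inj₁ refl = sameSign-before e
    ... | inj₂ refl = refl

    cycleVec-sym : ∀ a a′ → cycleVec a a′ ≡ cycleVec a′ a
    cycleVec-sym a a′ rewrite imprv-sym p a a′ | imprv-sym q a a′ = refl

    cycleVec-∉∉ : ∀ a a′ → isIn a (move W p) ≡ false → isIn a′ (move W p) ≡ false → cycleVec a a′ ≡ 0ℤ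
    cycleVec-∉∉ a a′ a∉ a′∉
      rewrite imprv-∉∉ p a a′ a∉ a′∉ | imprv-∉∉ q a a′ (trans (same-move a) a∉) (trans (same-move a′) a′∉)
      = cong (λ z → 0ℤ ℤ.+ (z ℤ.+ 0ℤ)) (ℤ.*-zeroʳ (signℤ (signs (Fin.suc Fin.zero))))

    cycleVec-∈∉ : ∀ a a′ → isIn a (move W p) ≡ true → isIn a′ (move W p) ≡ false →
                  cycleVec a a′ ≡ crossEntry (σ y) (ρ y) (σ a′) (ρ a′)
    cycleVec-∈∉ a a′ a∈ a′∉
      rewrite imprv-∈∉ p a a′ a∈ a′∉ | imprv-∈∉ q a a′ (trans (same-move a) a∈) (trans (same-move a′) a′∉)
            | endpoint-sign p-edge a a∈ | endpoint-sign q-edge a a∈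
            | tauAfter-∈ p y (joins-right p-joins) | tauAfter-∈ q y (joins-right q-joins)
      = refl

    ρ-∉ : ∀ a′ → isIn a′ (move W p) ≡ false → ρ a′ ≡ flips (occ a′ (segment W p q) % 2) (σ a′)
    ρ-∉ a′ a′∉ = trans (tauBefore-segment p q p<q a′ (trans (same-move a′) a′∉)) (flips-%2 (occ a′ (segment W p q)) (σ a′))

    cycleVec-unflipped : ∀ a a′ → isIn a (move W p) ≡ true → isIn a′ (move W p) ≡ false →
                         ¬ Flipped P a′ → cycleVec a a′ ≡ 0ℤ
    cycleVec-unflipped a a′ a∈ a′∉ unflipped = begin
      cycleVec a a′                         ≡⟨ cycleVec-∈∉ a a′ a∈ a′∉ ⟩
      crossEntry (σ y) (ρ y) (σ a′) (ρ a′)  ≡⟨ cong (crossEntry (σ y) (ρ y) (σ a′)) ρa′≡σa′ ⟩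
      crossEntry (σ y) (ρ y) (σ a′) (σ a′)  ≡⟨ crossEntry-≡ (σ y) (ρ y) (σ a′) ⟩
      0ℤ                                    ∎
      where
      open ≡-Reasoning
      even : occ a′ (segment W p q) % 2 ≡ 0
      even with m%2≡0⊎m%2≡1 (occ a′ (segment W p q))
      ... | inj₁ even = even
      ... | inj₂ odd  = ⊥-elim (unflipped (a′∉ , odd))
      ρa′≡σa′ : ρ a′ ≡ σ a′
      ρa′≡σa′ = trans (ρ-∉ a′ a′∉) (cong (λ k → flips k (σ a′)) even)

    cycleVec-flipped : ∀ a a′ → isIn a (move W p) ≡ true → Flipped P a′ → toℚ (cycleVec a a′) ≢ 0ℚ
    cycleVec-flipped a a′ a∈ (a′∉ , odd) =
      subst (λ z → toℚ z ≢ 0ℚ) (sym cross) (crossEntry-opposite (σ y) (ρ y) (σ a′))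
      where
      cross : cycleVec a a′ ≡ crossEntry (σ y) (ρ y) (σ a′) (Sign.opposite (σ a′))
      cross = trans (cycleVec-∈∉ a a′ a∈ a′∉)
                    (cong (crossEntry (σ y) (ρ y) (σ a′)) (trans (ρ-∉ a′ a′∉) (cong (λ k → flips k (σ a′)) odd)))

x∈p─q⇒x∉q : ∀ {n} {p q : Subset n} {x} → x ∈ p ─ q → x ∉ q
x∈p─q⇒x∉q {p = inside ∷ p} {outside ∷ q} here        ()
x∈p─q⇒x∉q {p = _ ∷ p}      {_ ∷ q}       (there x∈) (there x∈q) = x∈p─q⇒x∉q {p = p} {q} x∈ x∈q

x∈p-y⇒x≢y : ∀ {n} {p : Subset n} {x y} → x ∈ p - y → x ≢ y
x∈p-y⇒x≢y x∈ refl = x∈p─q⇒x∉q x∈ (x∈⁅x⁆ _)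

∣p∣≤1+∣p-x∣ : ∀ {n} (p : Subset n) x → ∣ p ∣ ≤ suc ∣ p - x ∣
∣p∣≤1+∣p-x∣ (inside  ∷ p) Fin.zero    = s≤s (ℕ.≤-reflexive (cong ∣_∣ (sym (p─⊥≡p p))))
∣p∣≤1+∣p-x∣ (outside ∷ p) Fin.zero    = ℕ.m≤n⇒m≤1+n (ℕ.≤-reflexive (cong ∣_∣ (sym (p─⊥≡p p))))
∣p∣≤1+∣p-x∣ (inside  ∷ p) (Fin.suc x) = s≤s (∣p∣≤1+∣p-x∣ p x)
∣p∣≤1+∣p-x∣ (outside ∷ p) (Fin.suc x) = ∣p∣≤1+∣p-x∣ p x

sumℚ-allFin-suc : ∀ {r} (f : Fin (suc r) → ℚ) →
                  sumℚ (map f (allFin (suc r))) ≡ f Fin.zero ℚ.+ sumℚ (map (f ∘ Fin.suc) (allFin r))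
sumℚ-allFin-suc f = cong (λ L → f Fin.zero ℚ.+ sumℚ L)
  (trans (List.map-tabulate Fin.suc f) (sym (List.map-tabulate id (f ∘ Fin.suc))))

sumℚ-allFin-zero : ∀ {r} (f : Fin r → ℚ) → (∀ i → f i ≡ 0ℚ) → sumℚ (map f (allFin r)) ≡ 0ℚ
sumℚ-allFin-zero {zero}  f f≡0 = refl
sumℚ-allFin-zero {suc r} f f≡0 = begin
  sumℚ (map f (allFin (suc r)))                      ≡⟨ sumℚ-allFin-suc f ⟩
  f Fin.zero ℚ.+ sumℚ (map (f ∘ Fin.suc) (allFin r)) ≡⟨ cong₂ ℚ._+_ (f≡0 Fin.zero)
                                                          (sumℚ-allFin-zero (f ∘ Fin.suc) (f≡0 ∘ Fin.suc)) ⟩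
  0ℚ                                                 ∎
  where open ≡-Reasoning

p*q≡0∧q≢0⇒p≡0 : ∀ (p q : ℚ) → p ℚ.* q ≡ 0ℚ → q ≢ 0ℚ → p ≡ 0ℚ
p*q≡0∧q≢0⇒p≡0 p q pq≡0 q≢0 = begin
  p                    ≡⟨ ℚ.*-identityʳ p ⟨
  p ℚ.* 1ℚ             ≡⟨ cong (p ℚ.*_) (ℚ.*-inverseʳ q) ⟨
  p ℚ.* (q ℚ.* q⁻¹)    ≡⟨ ℚ.*-assoc p q q⁻¹ ⟨
  (p ℚ.* q) ℚ.* q⁻¹    ≡⟨ cong (ℚ._* q⁻¹) pq≡0 ⟩
  0ℚ ℚ.* q⁻¹           ≡⟨ ℚ.*-zeroˡ q⁻¹ ⟩
  0ℚ                   ∎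
  where
  open ≡-Reasoning
  instance _ = ℚ.≢-nonZero q≢0
  q⁻¹ = ℚ.1/ q

module Elimination {n : ℕ} (W : MoveSeq n) (v : Fin n → EdgeVec n) where

  record PivotAt (x : Fin n) : Set where
    field
      a b     : Fin n
      a<b     : a Fin.< b
      a∈V     : InV W a
      b∈V     : InV W b
      nonzero : toℚ (v x a b) ≢ 0ℚ
  open PivotAt

  pivotAt : (∀ x c d → v x c d ≡ v x d c) →
            ∀ x c d → c ≢ d → InV W c → InV W d → toℚ (v x c d) ≢ 0ℚ →
            Σ (PivotAt x) λ e → ∀ x′ → v x′ (a e) (b e) ≡ v x′ c d
  pivotAt v-sym x c d c≢d c∈V d∈V nz with Fin.<-cmp c d
  ... | tri< c<d _ _ = record { a = c ; b = d ; a<b = c<d ; a∈V = c∈V ; b∈V = d∈V ; nonzero = nz } , λ _ → refl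
  ... | tri≈ _ c≡d _ = ⊥-elim (c≢d c≡d)
  ... | tri> _ _ d<c = record { a = d ; b = c ; a<b = d<c ; a∈V = d∈V ; b∈V = c∈V
                              ; nonzero = nz ∘ trans (cong toℚ (v-sym x c d)) } , λ x′ → v-sym x′ d c

  Pivot : Set
  Pivot = Σ (Fin n) PivotAt

  Triangular : List Pivot → Set
  Triangular []            = ⊤
  Triangular ((_ , e) ∷ L) = All (λ (x′ , _) → v x′ (a e) (b e) ≡ 0ℤ) L × Triangular L

  vectors : (L : List Pivot) → Fin (length L) → EdgeVec n
  vectors L i = v (proj₁ (lookup L i))

  triangular⇒LinIndep : ∀ L → Triangular L → LinIndep W (vectors L)
  triangular⇒LinIndep ((x , e) ∷ L) (later-vanish , tri) λs combination≡0 = λs≡0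
    where
    term : Fin n → Fin n → Fin (suc (length L)) → ℚ
    term a′ b′ i = λs i ℚ.* toℚ (vectors ((x , e) ∷ L) i a′ b′)

    tail-vanishes : ∀ i → term (a e) (b e) (Fin.suc i) ≡ 0ℚ
    tail-vanishes i = trans (cong (λ z → λs (Fin.suc i) ℚ.* toℚ z) (All.lookup later-vanish (∈-lookup {xs = L} i)))
                            (ℚ.*-zeroʳ (λs (Fin.suc i)))

    head-term≡0 : term (a e) (b e) Fin.zero ≡ 0ℚ
    head-term≡0 = begin
      T Fin.zero                                              ≡⟨ ℚ.+-identityʳ (T Fin.zero) ⟨
      T Fin.zero ℚ.+ 0ℚ                                       ≡⟨ cong (T Fin.zero ℚ.+_) (sumℚ-allFin-zero _ tail-vanishes) ⟨
      T Fin.zero ℚ.+ sumℚ (map (T ∘ Fin.suc) (allFin (length L))) ≡⟨ sumℚ-allFin-suc T ⟨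
      sumℚ (map T (allFin (suc (length L))))                  ≡⟨ combination≡0 (a e) (b e) (a<b e) (a∈V e) (b∈V e) ⟩
      0ℚ                                                      ∎
      where
      open ≡-Reasoning
      T : Fin (suc (length L)) → ℚ
      T = term (a e) (b e)

    λ₀≡0 : λs Fin.zero ≡ 0ℚ
    λ₀≡0 = p*q≡0∧q≢0⇒p≡0 (λs Fin.zero) _ head-term≡0 (nonzero e)

    head-term-vanishes : ∀ a′ b′ → term a′ b′ Fin.zero ≡ 0ℚ
    head-term-vanishes a′ b′ = trans (cong (ℚ._* toℚ (v x a′ b′)) λ₀≡0) (ℚ.*-zeroˡ (toℚ (v x a′ b′)))

    tail-combination≡0 : ∀ a′ b′ → a′ Fin.< b′ → InV W a′ → InV W b′ →
      sumℚ (map (λ i → λs (Fin.suc i) ℚ.* toℚ (vectors L i a′ b′)) (allFin (length L))) ≡ 0ℚ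
    tail-combination≡0 a′ b′ a′<b′ a′∈V b′∈V = begin
      S                                                   ≡⟨ ℚ.+-identityˡ S ⟨
      0ℚ ℚ.+ S                                            ≡⟨ cong (ℚ._+ S) (head-term-vanishes a′ b′) ⟨
      term a′ b′ Fin.zero ℚ.+ S                           ≡⟨ sumℚ-allFin-suc (term a′ b′) ⟨
      sumℚ (map (term a′ b′) (allFin (suc (length L))))   ≡⟨ combination≡0 a′ b′ a′<b′ a′∈V b′∈V ⟩
      0ℚ                                                  ∎
      where
      open ≡-Reasoning
      S : ℚ
      S = sumℚ (map (λ i → λs (Fin.suc i) ℚ.* toℚ (vectors L i a′ b′)) (allFin (length L)))

    λs≡0 : ∀ i → λs i ≡ 0ℚ
    λs≡0 Fin.zero    = λ₀≡0
    λs≡0 (Fin.suc i) = triangular⇒LinIndep L tri (λs ∘ Fin.suc) tail-combination≡0 i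

  record PivotIn (R : Subset n) : Set where
    field
      index    : Fin n
      pivot    : PivotAt index
      partner  : Fin n
      index∈R  : index ∈ R
      vanishes : ∀ x → x ∈ R → x ≢ index → x ≢ partner → v x (a pivot) (b pivot) ≡ 0ℤ

  record Eliminated (R : Subset n) : Set where
    field
      pivots     : List Pivot
      triangular : Triangular pivots
      indices∈R  : All (λ (x , _) → x ∈ R) pivots
      ∣R∣≤2r      : ∣ R ∣ ≤ 2 * length pivots

  eliminate : (D : Subset n) → (∀ R → R ⊆ D → Nonempty R → PivotIn R) →
              ∀ k R → ∣ R ∣ ≤ k → R ⊆ D → Eliminated R
  eliminate D pivotIn zero    R ∣R∣≤0 R⊆D = record { pivots = [] ; triangular = tt ; indices∈R = [] ; ∣R∣≤2r = ∣R∣≤0 }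
  eliminate D pivotIn (suc k) R ∣R∣≤k R⊆D with nonempty? R
  ... | no R-empty = record
    { pivots = [] ; triangular = tt ; indices∈R = []
    ; ∣R∣≤2r = ℕ.≤-reflexive (trans (cong ∣_∣ (Empty-unique R-empty)) (∣⊥∣≡0 n)) }
  ... | yes R-nonempty = record
    { pivots     = (index , pivot) ∷ pivots′
    ; triangular = All.map vanishes′ indices∈R′ , triangular′
    ; indices∈R  = index∈R ∷ All.map shrink indices∈R′
    ; ∣R∣≤2r      = bound
    }
    where
    open PivotIn (pivotIn R R⊆D R-nonempty)
    R′ : Subset n
    R′ = R - index - partner

    shrink : ∀ {x} → x ∈ R′ → x ∈ R
    shrink = p─q⊆p R ⁅ index ⁆ ∘ p─q⊆p (R - index) ⁅ partner ⁆

    vanishes′ : ∀ {x} → x ∈ R′ → v x (a pivot) (b pivot) ≡ 0ℤ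
    vanishes′ {x} x∈R′ =
      vanishes x (shrink x∈R′) (x∈p-y⇒x≢y (p─q⊆p (R - index) ⁅ partner ⁆ x∈R′)) (x∈p-y⇒x≢y x∈R′)

    ∣R′∣≤k : ∣ R′ ∣ ≤ k
    ∣R′∣≤k = ℕ.<⇒≤pred (ℕ.≤-<-trans (p⊆q⇒∣p∣≤∣q∣ (p─q⊆p (R - index) ⁅ partner ⁆))
                                    (ℕ.<-≤-trans (x∈p⇒∣p-x∣<∣p∣ index∈R) ∣R∣≤k))

    open Eliminated (eliminate D pivotIn k R′ ∣R′∣≤k (R⊆D ∘ shrink))
      renaming (pivots to pivots′; triangular to triangular′; indices∈R to indices∈R′; ∣R∣≤2r to ∣R′∣≤2r)

    bound : ∣ R ∣ ≤ 2 * suc (length pivots′)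
    bound = begin
      ∣ R ∣                          ≤⟨ ∣p∣≤1+∣p-x∣ R index ⟩
      suc ∣ R - index ∣              ≤⟨ s≤s (∣p∣≤1+∣p-x∣ (R - index) partner) ⟩
      suc (suc ∣ R′ ∣)               ≤⟨ s≤s (s≤s ∣R′∣≤2r) ⟩
      suc (suc (2 * length pivots′)) ≡⟨ ℕ.*-suc 2 (length pivots′) ⟨
      2 * suc (length pivots′)       ∎
      where open ℕ.≤-Reasoning

module CrossingPairs
  {n : ℕ} (W : MoveSeq n) (valid : Valid W) (τ₀ : Config n) (V₁ V₂ : Subset n)
  (V₁⊆V : ∀ x → x ∈ V₁ → InV W x) (V₁∩V₂≡∅ : ∀ x → x ∈ V₁ → x ∉ V₂)
  (E″ : Subset (length W)) (E″-cross : ∀ p → p ∈ E″ → CrossSameSign τ₀ W V₁ V₂ p)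
  (D : Subset n) (D-spec : ∀ x → x ∈ D ⇔ InD W E″ V₁ x)
  where

  open MoveSequence W τ₀
  module PP = ParallelPair
  open PairCycle

  crossEdge : ∀ {p x} → p ∈ E″ → x ∈ V₁ → isIn x (move W p) ≡ true →
              Σ (Fin n) λ y → y ∈ V₂ × SameSignEdge p x y
  crossEdge {p} {x} p∈E″ x∈V₁ x∈p with E″-cross p p∈E″
  ... | u , v , u≢v , p≡uv , sides , same = orient (sameSignEdge u≢v p≡uv same) sides
    where
    orient : SameSignEdge p u v → (u ∈ V₁ × v ∈ V₂) ⊎ (v ∈ V₁ × u ∈ V₂) → Σ (Fin n) λ y → y ∈ V₂ × SameSignEdge p x y
    orient e sides with joins-∈ (SameSignEdge.joins e) {x} x∈p | sides
    ... | inj₁ refl | inj₁ (_ , v∈V₂) = v , v∈V₂ , e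
    ... | inj₁ refl | inj₂ (_ , u∈V₂) = ⊥-elim (V₁∩V₂≡∅ x x∈V₁ u∈V₂)
    ... | inj₂ refl | inj₁ (_ , v∈V₂) = ⊥-elim (V₁∩V₂≡∅ x x∈V₁ v∈V₂)
    ... | inj₂ refl | inj₂ (_ , u∈V₂) = u , u∈V₂ , sameSignEdge-sym e

  crossPair : ∀ {x} → InD W E″ V₁ x → Σ (ParallelPair x) λ P → PP.y P ∈ V₂
  crossPair {x} (x∈V₁ , p , q , p≢q , p∈E″ , q∈E″ , x∈p , p~q) with crossEdge p∈E″ x∈V₁ x∈p
  ... | y , y∈V₂ , p-edge = ordered (ℕ.<-cmp (toℕ p) (toℕ q))
    where
    p-joins : Joins (move W p) x y
    p-joins = SameSignEdge.joins p-edge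
    q-joins : Joins (move W q) x y
    q-joins = joining λ w → trans (sym (p~q w)) (Joins.isIn-joins p-joins w)

    q-edge : SameSignEdge q x y
    q-edge with crossEdge q∈E″ x∈V₁ (joins-left q-joins)
    ... | y′ , y′∈V₂ , e with joins-∈ q-joins {y′} (joins-right (SameSignEdge.joins e))
    ...   | inj₁ refl = ⊥-elim (V₁∩V₂≡∅ x x∈V₁ y′∈V₂)
    ...   | inj₂ refl = e

    ordered : Tri (toℕ p < toℕ q) (toℕ p ≡ toℕ q) (toℕ q < toℕ p) → Σ (ParallelPair x) λ P → PP.y P ∈ V₂
    ordered (tri< p<q _ _) = record { y = y ; p = p ; q = q ; p<q = p<q ; p-edge = p-edge ; q-edge = q-edge } , y∈V₂
    ordered (tri≈ _ p≡q _) = ⊥-elim (p≢q (Fin.toℕ-injective p≡q))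
    ordered (tri> _ _ q<p) = record { y = y ; p = q ; q = p ; p<q = q<p ; p-edge = q-edge ; q-edge = p-edge } , y∈V₂

  pairOf : ∀ {x} → x ∈ D → ParallelPair x
  pairOf {x} x∈D = proj₁ (crossPair (Equivalence.to (D-spec x) x∈D))

  pairOf-y∈V₂ : ∀ {x} (x∈D : x ∈ D) → PP.y (pairOf x∈D) ∈ V₂
  pairOf-y∈V₂ {x} x∈D = proj₂ (crossPair (Equivalence.to (D-spec x) x∈D))

  vec : Fin n → EdgeVec n
  vec x with x ∈? D
  ... | yes x∈D = cycleVec (pairOf x∈D)
  ... | no _    = λ _ _ → 0ℤ

  vec-∈ : ∀ {x} (x∈D : x ∈ D) → vec x ≡ cycleVec (pairOf x∈D)
  vec-∈ {x} x∈D with x ∈? D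
  ... | yes x∈D′ = cong (cycleVec ∘ pairOf) ([]=-irrelevant x∈D′ x∈D)
  ... | no x∉D   = ⊥-elim (x∉D x∈D)

  vec-sym : ∀ x c d → vec x c d ≡ vec x d c
  vec-sym x c d with x ∈? D
  ... | yes x∈D = cycleVec-sym (pairOf x∈D) c d
  ... | no _    = refl

  vec-dependent : ∀ {x} → x ∈ D → DepCycleVec τ₀ W (vec x)
  vec-dependent x∈D = subst (DepCycleVec τ₀ W) (sym (vec-∈ x∈D)) (cycleVec-dependent (pairOf x∈D))

  outside-pair : ∀ {x c} (x∈D : x ∈ D) → c ∉ V₂ → c ≢ x → isIn c (move W (PP.p (pairOf x∈D))) ≡ false
  outside-pair x∈D c∉V₂ c≢x =
    joins-∉ (SameSignEdge.joins (PP.p-edge (pairOf x∈D))) c≢x λ { refl → c∉V₂ (pairOf-y∈V₂ x∈D) }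

  vec-vanishes : ∀ {x c d} (x∈D : x ∈ D) → isIn c (move W (PP.p (pairOf x∈D))) ≡ false →
                 isIn d (move W (PP.p (pairOf x∈D))) ≡ false → vec x c d ≡ 0ℤ
  vec-vanishes x∈D c∉ d∉ = trans (cong (λ u → u _ _) (vec-∈ x∈D)) (cycleVec-∉∉ (pairOf x∈D) _ _ c∉ d∉)

  open Elimination W vec using (PivotAt; pivotAt; PivotIn)
  open PivotAt using (a; b)

  flippedPivot : ∀ {x w} (x∈D : x ∈ D) → Flipped (pairOf x∈D) w →
                 Σ (PivotAt x) λ e → ∀ x′ → vec x′ (a e) (b e) ≡ vec x′ x w
  flippedPivot {x} {w} x∈D flipped@(w∉p , _) =
    pivotAt vec-sym x x w x≢w (V₁⊆V x x∈V₁) (flipped⇒InV P flipped) nonzero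
    where
    P : ParallelPair x
    P = pairOf x∈D
    x∈V₁ : x ∈ V₁
    x∈V₁ = proj₁ (Equivalence.to (D-spec x) x∈D)
    x∈p : isIn x (move W (PP.p P)) ≡ true
    x∈p = joins-left (SameSignEdge.joins (PP.p-edge P))
    x≢w : x ≢ w
    x≢w refl with trans (sym x∈p) w∉p
    ... | ()
    nonzero : toℚ (vec x x w) ≢ 0ℚ
    nonzero = subst (λ u → toℚ (u x w) ≢ 0ℚ) (sym (vec-∈ x∈D)) (cycleVec-flipped P x w x∈p flipped)

  OuterFlip : ∀ R → R ⊆ D → Fin n → Set
  OuterFlip R R⊆D x = Σ (x ∈ R) λ x∈R → ∃ λ w → Flipped (pairOf (R⊆D x∈R)) w × w ∉ V₂

  outerFlip? : ∀ R (R⊆D : R ⊆ D) → Decidable (OuterFlip R R⊆D)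
  outerFlip? R R⊆D x with x ∈? R
  ... | no x∉R  = no (x∉R ∘ proj₁)
  ... | yes x∈R = map′ (x∈R ,_) (λ (x∈R′ , flip) → subst (λ h → ∃ λ w → Flipped (pairOf (R⊆D h)) w × w ∉ V₂)
                                                          ([]=-irrelevant x∈R′ x∈R) flip)
                       (Fin.any? λ w → flipped? (pairOf (R⊆D x∈R)) w ×-dec ¬? (w ∈? V₂))

  x∈D⇒x∉V₂ : ∀ {x} → x ∈ D → x ∉ V₂
  x∈D⇒x∉V₂ {x} x∈D = V₁∩V₂≡∅ x (proj₁ (Equivalence.to (D-spec x) x∈D))

  -- If some x ∈ R has an odd node w ∉ V₂, no x′ ∈ R other than x and w
  -- meets {x, w}. Otherwise take any x ∈ R and any odd node w of it: an x′
  -- whose moves contain w but not x would have x as an odd node outside V₂.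
  pivotIn : ∀ R → R ⊆ D → Nonempty R → PivotIn R
  pivotIn R R⊆D (x₀ , x₀∈R) with Fin.any? (outerFlip? R R⊆D)
  ... | yes (x , x∈R , w , flipped , w∉V₂) = record
    { index = x ; pivot = proj₁ pivot ; partner = w ; index∈R = x∈R ; vanishes = vanishes }
    where
    pivot : Σ (PivotAt x) λ e → ∀ x′ → vec x′ (a e) (b e) ≡ vec x′ x w
    pivot = flippedPivot (R⊆D x∈R) flipped

    vanishes : ∀ x′ → x′ ∈ R → x′ ≢ x → x′ ≢ w → vec x′ (a (proj₁ pivot)) (b (proj₁ pivot)) ≡ 0ℤ
    vanishes x′ x′∈R x′≢x x′≢w = trans (proj₂ pivot x′)
      (vec-vanishes x′∈D (outside-pair x′∈D (x∈D⇒x∉V₂ (R⊆D x∈R)) (x′≢x ∘ sym))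
                         (outside-pair x′∈D w∉V₂ (x′≢w ∘ sym)))
      where
      x′∈D : x′ ∈ D
      x′∈D = R⊆D x′∈R
  ... | no noOuterFlip = record
    { index = x₀ ; pivot = proj₁ pivot ; partner = x₀ ; index∈R = x₀∈R ; vanishes = vanishes }
    where
    P : ParallelPair x₀
    P = pairOf (R⊆D x₀∈R)
    odd : ∃ (Flipped P)
    odd = valid (PP.p P) (PP.q P) (PP.p<q P)
    w : Fin n
    w = proj₁ odd
    pivot : Σ (PivotAt x₀) λ e → ∀ x′ → vec x′ (a e) (b e) ≡ vec x′ x₀ w
    pivot = flippedPivot (R⊆D x₀∈R) (proj₂ odd)

    vanishes : ∀ x′ → x′ ∈ R → x′ ≢ x₀ → x′ ≢ x₀ → vec x′ (a (proj₁ pivot)) (b (proj₁ pivot)) ≡ 0ℤ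
    vanishes x′ x′∈R x′≢x₀ _ = trans (proj₂ pivot x′) (vanishes-at (isIn w (move W (PP.p P′))) refl)
      where
      x′∈D : x′ ∈ D
      x′∈D = R⊆D x′∈R
      P′ : ParallelPair x′
      P′ = pairOf x′∈D
      x₀∉V₂ : x₀ ∉ V₂
      x₀∉V₂ = x∈D⇒x∉V₂ (R⊆D x₀∈R)
      x₀∉p′ : isIn x₀ (move W (PP.p P′)) ≡ false
      x₀∉p′ = outside-pair x′∈D x₀∉V₂ (x′≢x₀ ∘ sym)

      vanishes-at : ∀ w∈p′? → isIn w (move W (PP.p P′)) ≡ w∈p′? → vec x′ x₀ w ≡ 0ℤ
      vanishes-at false w∉p′ = vec-vanishes x′∈D x₀∉p′ w∉p′
      vanishes-at true  w∈p′ = begin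
        vec x′ x₀ w          ≡⟨ vec-sym x′ x₀ w ⟩
        vec x′ w x₀          ≡⟨ cong (λ u → u w x₀) (vec-∈ x′∈D) ⟩
        cycleVec P′ w x₀     ≡⟨ cycleVec-unflipped P′ w x₀ w∈p′ x₀∉p′
                                  (λ flip → noOuterFlip (x′ , x′∈R , x₀ , flip , x₀∉V₂)) ⟩
        0ℤ                   ∎
        where open ≡-Reasoning

lemma5p4 : ∀ {n} (W : MoveSeq n) → Valid W → (τ₀ : Config n)
    → (V₁ V₂ : Subset n)
    → (∀ x → x ∈ V₁ → InV W x) → (∀ x → x ∈ V₂ → InV W x)
    → (∀ x → x ∈ V₁ → x ∉ V₂)
    → (E″ : Subset (length W))
    → (∀ p → p ∈ E″ → CrossSameSign τ₀ W V₁ V₂ p)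
    → (D : Subset n) → (∀ x → x ∈ D ⇔ InD W E″ V₁ x)
    → ∃[ r ] (RankCyclesAtLeast τ₀ W r × ∣ D ∣ ≤ 2 * r)
lemma5p4 W valid τ₀ V₁ V₂ V₁⊆V _ V₁∩V₂≡∅ E″ E″-cross D D-spec =
  length pivots , (vectors pivots , dependent , triangular⇒LinIndep pivots triangular) , ∣R∣≤2r
  where
  open CrossingPairs W valid τ₀ V₁ V₂ V₁⊆V V₁∩V₂≡∅ E″ E″-cross D D-spec
  open Elimination W vec
  open Eliminated (eliminate D pivotIn ∣ D ∣ D ℕ.≤-refl id)

  dependent : ∀ i → DepCycleVec τ₀ W (vectors pivots i)
  dependent i = vec-dependent (All.lookup indices∈R (∈-lookup {xs = pivots} i))
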